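{- Let $n,d,r$ be positive integers, $\pi=(\pi_1\mid\cdots\mid\pi_d)\in\mathcal{OP}(n,d,r)$ and $w\in\mathfrak{S}_n$. Then $w\cdot[\pi]_r=\mathrm{sgn}(w)\,[w\cdot\pi]_r$, where $w\cdot\pi=(w\cdot\pi_1\mid\cdots\mid w\cdot\pi_d)$ with $w\cdot B=\{w(b):b\in B\}$.
   Context: An ordered set partition of $[n]$ with $d$ blocks is a sequence $\pi=(\pi_1\mid\cdots\mid\pi_d)$ of nonempty pairwise disjoint subsets of $[n]$ with union $[n]$; $\mathcal{OP}(n,d,r)$ is the set of those with every block of size at least $r$. Let $M=(x_{ij})_{1\le i,j\le n}$ be an $n\times n$ matrix of distinct indeterminates; $M_I^J$ is the determinant of the submatrix with rows $I$ and columns $J$ (both increasing). $\mathfrak{S}_n$ acts on $\mathbb{C}[M]$ by permuting columns: $w\cdot f$ is obtained from $f$ by substituting $x_{ij}\mapsto x_{i,w(j)}$. For $\pi\in\mathcal{OP}(n,d,r)$, an $r$-jellyfish tableau for $\pi$ is an array $T$ with $n-(d-1)r$ rows and $d$ columns, cells empty or containing elements of $[n]$, such that all cells in rows $1,\dots,r$ are nonempty, each row $i>r$ has exactly one nonempty cell, and the nonempty entries of column $j$ are exactly $\pi_j$, increasing downward; $\mathcal{J}_r(\pi)$ is their set. $\mathrm{sgn}(T)=(-1)^{\mathrm{inv}(T)}$, $\mathrm{inv}(T)$ being the number of inversions of the row reading word (rows left to right, top to bottom, empty cells skipped). $\mathrm{J}(T)=\prod_jM^{\pi_j}_{R_j(T)}$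 with $R_j(T)$ the set of rows in which column $j$ is nonempty, and $[\pi]_r=\sum_{T\in\mathcal{J}_r(\pi)}\mathrm{sgn}(T)\mathrm{J}(T)$. $\mathrm{sgn}(w)$ is the sign of the permutation $w$. -}

module Defs where

open import Level using (Level)
open import Algebra.Bundles using (CommutativeRing)
open import Data.Nat as ℕ using (ℕ; zero; suc; _∸_; _≤_; _<ᵇ_; _≡ᵇ_)
open import Data.Nat.Properties using (m∸n≤m)
open import Data.Fin as F using (Fin; toℕ; inject≤)
open import Data.Fin.Properties as FP using ()
open import Data.Fin.Subset using (Subset; _∈_; ∣_∣; Nonempty)
open import Data.Fin.Subset.Properties using (_∈?_)
open import Data.Fin.Permutation using (Permutation′; _⟨$⟩ʳ_; _⟨$⟩ˡ_)
open import Data.List as L using (List; []; _∷_; [_]; filter; filterᵇ; allFin; concatMap; catMaybes; upTo; zipWith; length; foldr)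
open import Data.Bool.ListAction using (and)
import Data.List.Properties as LP
open import Data.Vec as V using (Vec; lookup; tabulate)
open import Data.Maybe using (Maybe; just; nothing; is-just)
open import Data.Bool using (Bool; true; false; _∧_; if_then_else_)
open import Data.Product using (_×_; _,_; Σ; ∃)
import Data.Product
open import Relation.Binary.PropositionalEquality using (_≡_)
open import Relation.Nullary.Decidable using (⌊_⌋)

record IsOP (n d r : ℕ) (π : Fin d → Subset n) : Set where
  field
    nonempty : ∀ j → Nonempty (π j)
    disjoint : ∀ i j (x : Fin n) → x ∈ π i → x ∈ π j → i ≡ j
    covering : ∀ (x : Fin n) → ∃ λ j → x ∈ π j
    blockSize : ∀ j → r ≤ ∣ π j ∣

allB : ∀ {a} {A : Set a} → (A → Bool) → List A → Bool
allB p xs = and (L.map p xs)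

elems : ∀ {n} → Subset n → List (Fin n)
elems {n} p = filter (_∈? p) (allFin n)

inversions : ∀ {n} → List (Fin n) → ℕ
inversions [] = 0
inversions (x ∷ xs) = length (filter (F._<? x) xs) ℕ.+ inversions xs

-- Tableaux: arrays with N rows and d columns, cells empty (nothing) or
-- containing an element of [n].

Tableau : ℕ → ℕ → ℕ → Set
Tableau n d N = Vec (Vec (Maybe (Fin n)) d) N

vecs : ∀ {a} {A : Set a} → List A → (k : ℕ) → List (Vec A k)
vecs xs zero = [ V.[] ]
vecs xs (suc k) = concatMap (λ x → L.map (x V.∷_) (vecs xs k)) xs

allTableaux : ∀ n d N → List (Tableau n d N)
allTableaux n d N = vecs (vecs (nothing ∷ L.map just (allFin n)) d) N

jRows : ℕ → ℕ → ℕ → ℕ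
jRows n d r = n ∸ ((d ∸ 1) ℕ.* r)

module _ {n d N : ℕ} (T : Tableau n d N) where

  colEntries : Fin d → List (Fin n)
  colEntries j = catMaybes (V.toList (V.map (λ row → lookup row j) T))

  rowsOf : Fin d → List (Fin N)
  rowsOf j = filterᵇ (λ i → is-just (lookup (lookup T i) j)) (allFin N)

  readingWord : List (Fin n)
  readingWord = concatMap (λ row → catMaybes (V.toList row)) (V.toList T)

-- T is an r-jellyfish tableau for π (rows indexed from 0, so "rows 1..r"
-- are the rows with index < r)
isJellyfish : ∀ {n d N} (r : ℕ) (π : Fin d → Subset n) → Tableau n d N → Bool
isJellyfish {n} {d} {N} r π T =
  allB rowOK (allFin N) ∧ allB colOK (allFin d)
  where
  rowOK : Fin N → Bool
  rowOK i =
    if toℕ i <ᵇ r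
    then allB is-just (V.toList (lookup T i))
    else (length (catMaybes (V.toList (lookup T i))) ≡ᵇ 1)
  colOK : Fin d → Bool
  colOK j = ⌊ LP.≡-dec F._≟_ (colEntries T j) (elems (π j)) ⌋

jellyfish : ∀ {n d} (r : ℕ) (π : Fin d → Subset n) → List (Tableau n d (jRows n d r))
jellyfish {n} {d} r π = filterᵇ (isJellyfish r π) (allTableaux n d (jRows n d r))

-- w · B = { w(b) : b ∈ B }   (k ∈ w·B iff w⁻¹(k) ∈ B)
actBlock : ∀ {n} → Permutation′ n → Subset n → Subset n
actBlock w B = tabulate (λ k → lookup B (w ⟨$⟩ˡ k))

actPartition : ∀ {n d} → Permutation′ n → (Fin d → Subset n) → (Fin d → Subset n)
actPartition w π j = actBlock w (π j)

picks : ∀ {a} {A : Set a} → List A → List (A × List A)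
picks [] = []
picks (x ∷ xs) = (x , xs) ∷ L.map (λ { (y , ys) → y , x ∷ ys }) (picks xs)

-- Polynomial-level notions, evaluated at a matrix X over a commutative ring

module _ {c ℓ : Level} (R : CommutativeRing c ℓ) where
  open CommutativeRing R

  sumR : List Carrier → Carrier
  sumR = foldr _+_ 0#

  prodR : List Carrier → Carrier
  prodR = foldr _*_ 1#

  signR : ℕ → Carrier
  signR zero = 1#
  signR (suc k) = - signR k

  minorDet : ∀ {m k} → (Fin m → Fin k → Carrier) → List (Fin m) → List (Fin k) → Carrier
  minorDet X [] [] = 1#
  minorDet X [] (_ ∷ _) = 0#
  minorDet X (i ∷ is) js =
    sumR (zipWith (λ p jr → signR p * (X i (Data.Product.proj₁ jr) * minorDet X is (Data.Product.proj₂ jr)))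
                  (upTo (length js)) (picks js))

  sgnPerm : ∀ {n} → Permutation′ n → Carrier
  sgnPerm {n} w = signR (inversions (L.map (w ⟨$⟩ʳ_) (allFin n)))

  -- (w · f)(X) = f(X') with X'_{ij} = X_{i,w(j)}  (substitution x_ij ↦ x_{i,w(j)})
  actMatrix : ∀ {n} → Permutation′ n → (Fin n → Fin n → Carrier) → (Fin n → Fin n → Carrier)
  actMatrix w X i j = X i (w ⟨$⟩ʳ j)

  jMonomial : ∀ {n d} (r : ℕ) (π : Fin d → Subset n) → (Fin n → Fin n → Carrier)
            → Tableau n d (jRows n d r) → Carrier
  jMonomial {n} {d} r π X T =
    prodR (L.map (λ j → minorDet X (L.map emb (rowsOf T j)) (elems (π j))) (allFin d))
    where
    emb : Fin (jRows n d r) → Fin n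
    emb i = inject≤ i (m∸n≤m n ((d ∸ 1) ℕ.* r))

  bracket : ∀ {n d} (r : ℕ) (π : Fin d → Subset n) → (Fin n → Fin n → Carrier) → Carrier
  bracket r π X =
    sumR (L.map (λ T → signR (inversions (readingWord T)) * jMonomial r π X T) (jellyfish r π))

{-# OPTIONS --safe #-}
-- If k is a descent of w and s = (k k+1), then w′ = w ∘ s has one inversion less, so by
-- induction it suffices to show [π]_r(s·X) = −[s·π]_r(X); a permutation without descents is
-- the identity. If k and k+1 lie in one block π_j, then s·π = π and in every J(T) the substitution
-- swaps two adjacent columns of the minor with columns π_j, so every term changes sign.
-- Otherwise relabelling the entries of tableaux by s is a bijection 𝒥_r(π) → 𝒥_r(s·π) carrying
-- J(T)(s·X) to J(s·T)(X); as k and k+1 occur exactly once in the reading word of a jellyfish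
-- tableau, the relabelling changes its number of inversions by exactly one.
module Submission where

open import Defs
open import Level using (Level; _⊔_)
open import Algebra.Bundles using (CommutativeRing)
open import Data.Nat as ℕ using (ℕ; zero; suc; _≤_; _<_; _<ᵇ_; _≡ᵇ_; z≤n; s≤s)
import Data.Nat.Properties as ℕP
open import Data.Fin as F using (Fin; toℕ; inject₁; _≟_; _<?_)
import Data.Fin.Properties as FP
open import Data.Fin.Subset using (Subset; _∈_)
open import Data.Fin.Subset.Properties using (_∈?_)
open import Data.Fin.Permutation using (Permutation′; permutation; _⟨$⟩ʳ_; _⟨$⟩ˡ_; inverseˡ; _∘ₚ_)
open import Data.List as L using (List; []; _∷_; _++_; map; zipWith; applyUpTo; concatMap; filter; filterᵇ; length; allFin; tabulate; catMaybes)
import Data.List.Properties as LP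
open import Data.List.Relation.Binary.Permutation.Propositional as ↭
  using (_↭_; ↭-refl; ↭-sym; ↭-trans; ↭-reflexive; prep; swap)
import Data.List.Relation.Binary.Permutation.Propositional.Properties as ↭P
open import Data.List.Relation.Unary.All as All using (All; []; _∷_)
open import Data.Vec as V using (lookup)
import Data.Vec.Properties as VP
open import Data.Maybe as M using (Maybe; just; nothing; is-just)
open import Data.Bool as Bool using (Bool; true; false; _∧_; if_then_else_)
open import Data.Bool.ListAction using (and)
open import Data.Bool.Properties using (T-∧)
open import Data.List.Relation.Unary.All.Properties using (all⁺; tabulate⁻; all-filter)
open import Data.Product using (_×_; _,_; proj₁; proj₂; ∃; ∃₂)
open import Data.Sum using (_⊎_; inj₁; inj₂)
open import Data.Empty using (⊥; ⊥-elim)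
open import Function using (_∘_; id; mk⇔; Equivalence)
open import Function.Definitions using (Injective)
open import Relation.Nullary using (Dec; does; yes; no; ¬_; contradiction)
open import Relation.Nullary.Decidable using (_×-dec_; dec-true; dec-false; does-⇔; isYes≗does; ⌊_⌋; T?; toWitness)
open import Relation.Binary.PropositionalEquality
  using (_≡_; _≢_; refl; sym; trans; cong; cong₂; subst; module ≡-Reasoning)

filterᵇ-cong : ∀ {a} {A : Set a} {p q : A → Bool} → (∀ x → p x ≡ q x) → ∀ xs → filterᵇ p xs ≡ filterᵇ q xs
filterᵇ-cong {p = p} {q} p≗q =
  LP.filter-≐ (T? ∘ p) (T? ∘ q) ((λ {x} → subst Bool.T (p≗q x)) , (λ {x} → subst Bool.T (sym (p≗q x))))

filterᵇ-map : ∀ {a b} {A : Set a} {B : Set b} (p : B → Bool) (f : A → B) xs →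
  filterᵇ p (map f xs) ≡ map f (filterᵇ (p ∘ f) xs)
filterᵇ-map p f [] = refl
filterᵇ-map p f (x ∷ xs) with p (f x)
... | true  = cong (f x ∷_) (filterᵇ-map p f xs)
... | false = filterᵇ-map p f xs

concatMap-cong-↭ : ∀ {a b} {A : Set a} {B : Set b} {f g : A → List B} → (∀ x → f x ↭ g x) →
  ∀ xs → concatMap f xs ↭ concatMap g xs
concatMap-cong-↭ f↭g []       = ↭-refl
concatMap-cong-↭ f↭g (x ∷ xs) = ↭P.++⁺ (f↭g x) (concatMap-cong-↭ f↭g xs)

concatMap-↭ : ∀ {a b} {A : Set a} {B : Set b} (f : A → List B) {xs ys} → xs ↭ ys → concatMap f xs ↭ concatMap f ys
concatMap-↭ f ↭.refl           = ↭-refl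
concatMap-↭ f (prep x p)       = ↭P.++⁺ˡ (f x) (concatMap-↭ f p)
concatMap-↭ f (swap x y p)     = ↭-trans (↭P.shifts (f x) (f y)) (↭P.++⁺ˡ (f y) (↭P.++⁺ˡ (f x) (concatMap-↭ f p)))
concatMap-↭ f (↭.trans p q)    = ↭-trans (concatMap-↭ f p) (concatMap-↭ f q)

vecs-↭ : ∀ {a} {A : Set a} {xs ys : List A} → xs ↭ ys → ∀ k → vecs xs k ↭ vecs ys k
vecs-↭ p zero = ↭-refl
vecs-↭ {xs = xs} {ys} p (suc k) =
  ↭-trans (concatMap-cong-↭ (λ x → ↭P.map⁺ (x V.∷_) (vecs-↭ p k)) xs) (concatMap-↭ (λ y → map (y V.∷_) (vecs ys k)) p)

map-vecs : ∀ {a b} {A : Set a} {B : Set b} (f : A → B) xs k → map (V.map f) (vecs xs k) ≡ vecs (map f xs) k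
map-vecs f xs zero = refl
map-vecs f xs (suc k) = begin
    map (V.map f) (concatMap (λ x → map (x V.∷_) (vecs xs k)) xs)
  ≡⟨ LP.map-concatMap (V.map f) _ xs ⟩
    concatMap (λ x → map (V.map f) (map (x V.∷_) (vecs xs k))) xs
  ≡⟨ LP.concatMap-cong (λ x → trans (sym (LP.map-∘ (vecs xs k))) (trans (LP.map-∘ (vecs xs k))
                                (cong (map (f x V.∷_)) (map-vecs f xs k)))) xs ⟩
    concatMap (λ x → map (f x V.∷_) (vecs (map f xs) k)) xs
  ≡⟨ sym (LP.concatMap-map (λ y → map (y V.∷_) (vecs (map f xs) k)) f xs) ⟩
    concatMap (λ y → map (y V.∷_) (vecs (map f xs) k)) (map f xs)
  ∎
  where open ≡-Reasoning

-- Adjacent transpositions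

swapAdj : ∀ {n} → Fin n → Fin (suc n) → Fin (suc n)
swapAdj F.zero    F.zero                = F.suc F.zero
swapAdj F.zero    (F.suc F.zero)        = F.zero
swapAdj F.zero    (F.suc (F.suc i))     = F.suc (F.suc i)
swapAdj (F.suc k) F.zero                = F.zero
swapAdj (F.suc k) (F.suc i)             = F.suc (swapAdj k i)

swapAdj-involutive : ∀ {n} (k : Fin n) i → swapAdj k (swapAdj k i) ≡ i
swapAdj-involutive F.zero    F.zero            = refl
swapAdj-involutive F.zero    (F.suc F.zero)    = refl
swapAdj-involutive F.zero    (F.suc (F.suc i)) = refl
swapAdj-involutive (F.suc k) F.zero            = refl
swapAdj-involutive (F.suc k) (F.suc i)         = cong F.suc (swapAdj-involutive k i)

swapAdjPerm : ∀ {n} → Fin n → Permutation′ (suc n)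
swapAdjPerm k = permutation (swapAdj k) (swapAdj k) (swapAdj-involutive k) (swapAdj-involutive k)

inject₁≢suc : ∀ {n} (k : Fin n) → inject₁ k ≢ F.suc k
inject₁≢suc F.zero    ()
inject₁≢suc (F.suc k) e = inject₁≢suc k (FP.suc-injective e)

tabulate-swapAdj : ∀ {a} {A : Set a} {n} (k : Fin n) (f : Fin (suc n) → A) →
  ∃₂ λ U V → tabulate f ≡ U ++ f (inject₁ k) ∷ f (F.suc k) ∷ V
           × tabulate (f ∘ swapAdj k) ≡ U ++ f (F.suc k) ∷ f (inject₁ k) ∷ V
tabulate-swapAdj F.zero    f = [] , tabulate (f ∘ F.suc ∘ F.suc) , refl , refl
tabulate-swapAdj (F.suc k) f with tabulate-swapAdj k (f ∘ F.suc)
... | U , V , p , q = f F.zero ∷ U , V , cong (f F.zero ∷_) p , cong (f F.zero ∷_) q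

swapAdj-injective : ∀ {n} (k : Fin n) → Injective _≡_ _≡_ (swapAdj k)
swapAdj-injective k {x} {y} sx≡sy =
  trans (sym (swapAdj-involutive k x)) (trans (cong (swapAdj k) sx≡sy) (swapAdj-involutive k y))

swapAdj-permutes-allFin : ∀ {n} (k : Fin n) → map (swapAdj k) (allFin (suc n)) ↭ allFin (suc n)
swapAdj-permutes-allFin k with tabulate-swapAdj k id
... | U , V , sorted , swapped =
  ↭-trans (↭-reflexive (trans (LP.map-tabulate id (swapAdj k)) swapped))
          (↭-trans (↭P.++⁺ˡ U (swap _ _ ↭-refl)) (↭-reflexive (sym sorted)))

-- Subsets as increasing lists

members : ∀ {n} → Subset n → List (Fin n)
members V.[]          = []
members (true  V.∷ B) = F.zero ∷ map F.suc (members B)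
members (false V.∷ B) = map F.suc (members B)

elems-tail : ∀ {n} b (B : Subset n) → filter (_∈? (b V.∷ B)) (tabulate F.suc) ≡ map F.suc (members B)

elems≡members : ∀ {n} (B : Subset n) → elems B ≡ members B
elems≡members V.[]          = refl
elems≡members (true  V.∷ B) = cong (F.zero ∷_) (elems-tail true B)
elems≡members (false V.∷ B) = elems-tail false B

elems-tail {n} b B =
  trans (cong (filter (_∈? (b V.∷ B))) (sym (LP.map-tabulate id F.suc)))
        (trans (filter-map-suc (allFin n)) (cong (map F.suc) (elems≡members B)))
  where
  filter-map-suc : ∀ xs → filter (_∈? (b V.∷ B)) (map F.suc xs) ≡ map F.suc (filter (_∈? B) xs)
  filter-map-suc [] = refl
  filter-map-suc (x ∷ xs) with does (x ∈? B)
  ... | true  = cong (F.suc x ∷_) (filter-map-suc xs)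
  ... | false = filter-map-suc xs

actBlock-swapAdj-zero : ∀ {n} x y (B : Subset n) → actBlock (swapAdjPerm F.zero) (x V.∷ y V.∷ B) ≡ y V.∷ x V.∷ B
actBlock-swapAdj-zero x y B = cong (λ C → y V.∷ x V.∷ C) (VP.tabulate∘lookup B)

map-swapAdj-zero-suc-suc : ∀ {n} (xs : List (Fin n)) →
  map (swapAdj F.zero) (map F.suc (map F.suc xs)) ≡ map F.suc (map F.suc xs)
map-swapAdj-zero-suc-suc []       = refl
map-swapAdj-zero-suc-suc (x ∷ xs) = cong (F.suc (F.suc x) ∷_) (map-swapAdj-zero-suc-suc xs)

map-swapAdj-suc : ∀ {n} (k : Fin n) xs → map (swapAdj (F.suc k)) (map F.suc xs) ≡ map F.suc (map (swapAdj k) xs)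
map-swapAdj-suc k xs = trans (sym (LP.map-∘ xs)) (LP.map-∘ xs)

actBlock-swapAdj-fixes : ∀ {n} (k : Fin n) B → lookup B (inject₁ k) ≡ lookup B (F.suc k) →
  actBlock (swapAdjPerm k) B ≡ B
actBlock-swapAdj-fixes F.zero (x V.∷ y V.∷ B) refl = actBlock-swapAdj-zero x x B
actBlock-swapAdj-fixes (F.suc k) (x V.∷ B) e = cong (x V.∷_) (actBlock-swapAdj-fixes k B e)

members-actBlock-swapAdj : ∀ {n} (k : Fin n) B →
  (lookup B (inject₁ k) ≡ true → lookup B (F.suc k) ≡ true → ⊥) →
  members (actBlock (swapAdjPerm k) B) ≡ map (swapAdj k) (members B)
members-actBlock-swapAdj F.zero (true V.∷ true V.∷ B) notBoth = ⊥-elim (notBoth refl refl)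
members-actBlock-swapAdj F.zero (true V.∷ false V.∷ B) _ =
  trans (cong members (actBlock-swapAdj-zero true false B))
        (cong (F.suc F.zero ∷_) (sym (map-swapAdj-zero-suc-suc (members B))))
members-actBlock-swapAdj F.zero (false V.∷ true V.∷ B) _ =
  trans (cong members (actBlock-swapAdj-zero false true B))
        (cong (F.zero ∷_) (sym (map-swapAdj-zero-suc-suc (members B))))
members-actBlock-swapAdj F.zero (false V.∷ false V.∷ B) _ =
  trans (cong members (actBlock-swapAdj-zero false false B)) (sym (map-swapAdj-zero-suc-suc (members B)))
members-actBlock-swapAdj (F.suc k) (true V.∷ B) notBoth =
  cong (F.zero ∷_) (trans (cong (map F.suc) (members-actBlock-swapAdj k B notBoth)) (sym (map-swapAdj-suc k (members B))))
members-actBlock-swapAdj (F.suc k) (false V.∷ B) notBoth =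
  trans (cong (map F.suc) (members-actBlock-swapAdj k B notBoth)) (sym (map-swapAdj-suc k (members B)))

members-swapAdj-both : ∀ {n} (k : Fin n) B → lookup B (inject₁ k) ≡ true → lookup B (F.suc k) ≡ true →
  ∃₂ λ U W → members B ≡ U ++ inject₁ k ∷ F.suc k ∷ W
           × map (swapAdj k) (members B) ≡ U ++ F.suc k ∷ inject₁ k ∷ W
members-swapAdj-both F.zero (true V.∷ true V.∷ B) refl refl =
  [] , map F.suc (map F.suc (members B)) , refl ,
  cong (λ W → F.suc F.zero ∷ F.zero ∷ W) (map-swapAdj-zero-suc-suc (members B))
members-swapAdj-both (F.suc k) (true V.∷ B) ∈a ∈b with members-swapAdj-both k B ∈a ∈b
... | U , W , p , q =
  F.zero ∷ map F.suc U , map F.suc W ,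
  cong (F.zero ∷_) (trans (cong (map F.suc) p) (LP.map-++ F.suc U _)) ,
  cong (F.zero ∷_) (trans (map-swapAdj-suc k (members B)) (trans (cong (map F.suc) q) (LP.map-++ F.suc U _)))
members-swapAdj-both (F.suc k) (false V.∷ B) ∈a ∈b with members-swapAdj-both k B ∈a ∈b
... | U , W , p , q =
  map F.suc U , map F.suc W ,
  trans (cong (map F.suc) p) (LP.map-++ F.suc U _) ,
  trans (map-swapAdj-suc k (members B)) (trans (cong (map F.suc) q) (LP.map-++ F.suc U _))

-- Tableaux

mapTableau : ∀ {n m d N} → (Fin n → Fin m) → Tableau n d N → Tableau m d N
mapTableau f = V.map (V.map (M.map f))

module _ {n m : ℕ} (f : Fin n → Fin m) where

  is-just-map : ∀ c → is-just (M.map f c) ≡ is-just c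
  is-just-map nothing  = refl
  is-just-map (just _) = refl

  catMaybes-toList-map : ∀ {d} (row : V.Vec (Maybe (Fin n)) d) →
    catMaybes (V.toList (V.map (M.map f) row)) ≡ map f (catMaybes (V.toList row))
  catMaybes-toList-map row = trans (cong catMaybes (VP.toList-map (M.map f) row)) (sym (LP.map-catMaybes f (V.toList row)))

  lookup-mapTableau : ∀ {d N} (T : Tableau n d N) i j →
    lookup (lookup (mapTableau f T) i) j ≡ M.map f (lookup (lookup T i) j)
  lookup-mapTableau T i j =
    trans (cong (λ row → lookup row j) (VP.lookup-map i (V.map (M.map f)) T)) (VP.lookup-map j (M.map f) (lookup T i))

  rowsOf-mapTableau : ∀ {d N} (T : Tableau n d N) j → rowsOf (mapTableau f T) j ≡ rowsOf T j
  rowsOf-mapTableau {N = N} T j =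
    filterᵇ-cong (λ i → trans (cong is-just (lookup-mapTableau T i j)) (is-just-map (lookup (lookup T i) j))) (allFin N)

  colEntries-mapTableau : ∀ {d N} (T : Tableau n d N) j → colEntries (mapTableau f T) j ≡ map f (colEntries T j)
  colEntries-mapTableau T j = trans (cong (catMaybes ∘ V.toList) column) (catMaybes-toList-map (V.map (λ row → lookup row j) T))
    where
    column : V.map (λ row → lookup row j) (mapTableau f T) ≡ V.map (M.map f) (V.map (λ row → lookup row j) T)
    column = trans (sym (VP.map-∘ _ _ T)) (trans (VP.map-cong (VP.lookup-map j (M.map f)) T) (VP.map-∘ _ _ T))

  readingWord-mapTableau : ∀ {d N} (T : Tableau n d N) → readingWord (mapTableau f T) ≡ map f (readingWord T)
  readingWord-mapTableau V.[]          = refl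
  readingWord-mapTableau (row V.∷ T) =
    trans (cong₂ _++_ (catMaybes-toList-map row) (readingWord-mapTableau T))
          (sym (LP.map-++ f (catMaybes (V.toList row)) (readingWord T)))

  allB-is-just-map : ∀ {d} (row : V.Vec (Maybe (Fin n)) d) →
    allB is-just (V.toList (V.map (M.map f) row)) ≡ allB is-just (V.toList row)
  allB-is-just-map row =
    cong and (trans (cong (map is-just) (VP.toList-map (M.map f) row))
                    (trans (sym (LP.map-∘ (V.toList row))) (LP.map-cong is-just-map (V.toList row))))

  length-catMaybes-map : ∀ {d} (row : V.Vec (Maybe (Fin n)) d) →
    length (catMaybes (V.toList (V.map (M.map f) row))) ≡ length (catMaybes (V.toList row))
  length-catMaybes-map row = trans (cong length (catMaybes-toList-map row)) (LP.length-map f (catMaybes (V.toList row)))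

  isJellyfish-mapTableau : ∀ {d N} r (π : Fin d → Subset n) (π′ : Fin d → Subset m) → Injective _≡_ _≡_ f →
    (∀ j → map f (elems (π j)) ≡ elems (π′ j)) →
    ∀ (T : Tableau n d N) → isJellyfish r π′ (mapTableau f T) ≡ isJellyfish r π T
  isJellyfish-mapTableau {d} {N} r π π′ f-injective blocks T =
    cong₂ _∧_ (cong and (LP.map-cong rowShape (allFin N))) (cong and (LP.map-cong column (allFin d)))
    where
    rowShape : ∀ i →
      (if toℕ i <ᵇ r then allB is-just (V.toList (lookup (mapTableau f T) i))
                     else (length (catMaybes (V.toList (lookup (mapTableau f T) i))) ≡ᵇ 1))
      ≡ (if toℕ i <ᵇ r then allB is-just (V.toList (lookup T i))
                       else (length (catMaybes (V.toList (lookup T i))) ≡ᵇ 1))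
    rowShape i rewrite VP.lookup-map i (V.map (M.map f)) T =
      cong₂ (if toℕ i <ᵇ r then_else_) (allB-is-just-map (lookup T i)) (cong (_≡ᵇ 1) (length-catMaybes-map (lookup T i)))
    column : ∀ j → ⌊ LP.≡-dec _≟_ (colEntries (mapTableau f T) j) (elems (π′ j)) ⌋
                 ≡ ⌊ LP.≡-dec _≟_ (colEntries T j) (elems (π j)) ⌋
    column j rewrite colEntries-mapTableau T j | sym (blocks j) =
      trans (isYes≗does mapped) (trans (does-⇔ (mk⇔ (LP.map-injective f-injective) (cong (map f))) mapped original)
                                       (sym (isYes≗does original)))
      where
      mapped : Dec (map f (colEntries T j) ≡ map f (elems (π j)))
      mapped = LP.≡-dec _≟_ (map f (colEntries T j)) (map f (elems (π j)))
      original : Dec (colEntries T j ≡ elems (π j))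
      original = LP.≡-dec _≟_ (colEntries T j) (elems (π j))

allTableaux-mapTableau-↭ : ∀ {n} (f : Fin n → Fin n) → map f (allFin n) ↭ allFin n →
  ∀ d N → map (mapTableau f) (allTableaux n d N) ↭ allTableaux n d N
allTableaux-mapTableau-↭ {n} f f-permutes d N =
  ↭-trans (↭-reflexive (trans (map-vecs (V.map (M.map f)) _ N) (cong (λ cs → vecs cs N) (map-vecs (M.map f) cells d))))
          (vecs-↭ (vecs-↭ cells-↭ d) N)
  where
  cells : List (Maybe (Fin n))
  cells = nothing ∷ map just (allFin n)
  cells-↭ : map (M.map f) cells ↭ cells
  cells-↭ = prep nothing (↭-trans (↭-reflexive (trans (sym (LP.map-∘ (allFin n))) (LP.map-∘ (allFin n))))
                                  (↭P.map⁺ just f-permutes))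

jellyfish-mapTableau-↭ : ∀ {n d} r (π π′ : Fin d → Subset n) (f : Fin n → Fin n) →
  Injective _≡_ _≡_ f → map f (allFin n) ↭ allFin n → (∀ j → map f (elems (π j)) ≡ elems (π′ j)) →
  jellyfish r π′ ↭ map (mapTableau f) (jellyfish r π)
jellyfish-mapTableau-↭ {n} {d} r π π′ f f-injective f-permutes blocks = ↭-trans
  (↭P.filter-↭ (T? ∘ isJellyfish r π′) (↭-sym (allTableaux-mapTableau-↭ f f-permutes d (jRows n d r))))
  (↭-reflexive (trans (filterᵇ-map (isJellyfish r π′) (mapTableau f) tableaux)
                      (cong (map (mapTableau f))
                            (filterᵇ-cong (isJellyfish-mapTableau f r π π′ f-injective blocks) tableaux))))
  where
  tableaux : List (Tableau n d (jRows n d r))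
  tableaux = allTableaux n d (jRows n d r)

record IsPartition {n d} (π : Fin d → Subset n) : Set where
  field
    disjoint : ∀ i j x → x ∈ π i → x ∈ π j → i ≡ j
    covering : ∀ x → ∃ λ j → x ∈ π j

∈-actBlock⁺ : ∀ {n} (w : Permutation′ n) {B x} → (w ⟨$⟩ˡ x) ∈ B → x ∈ actBlock w B
∈-actBlock⁺ w {B} {x} wx∈B = VP.lookup⇒[]= x _ (trans (VP.lookup∘tabulate _ x) (VP.[]=⇒lookup wx∈B))

∈-actBlock⁻ : ∀ {n} (w : Permutation′ n) {B x} → x ∈ actBlock w B → (w ⟨$⟩ˡ x) ∈ B
∈-actBlock⁻ w {B} {x} x∈wB = VP.lookup⇒[]= (w ⟨$⟩ˡ x) B (trans (sym (VP.lookup∘tabulate _ x)) (VP.[]=⇒lookup x∈wB))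

isPartition-act : ∀ {n d} (w : Permutation′ n) {π : Fin d → Subset n} → IsPartition π → IsPartition (actPartition w π)
isPartition-act w part = record
  { disjoint = λ i j x x∈i x∈j → disjoint i j (w ⟨$⟩ˡ x) (∈-actBlock⁻ w x∈i) (∈-actBlock⁻ w x∈j)
  ; covering = λ x → proj₁ (covering (w ⟨$⟩ˡ x)) , ∈-actBlock⁺ w (proj₂ (covering (w ⟨$⟩ˡ x)))
  }
  where open IsPartition part

isOP⇒isPartition : ∀ {n d r} {π : Fin d → Subset n} → IsOP n d r π → IsPartition π
isOP⇒isPartition op = record { disjoint = IsOP.disjoint op ; covering = IsOP.covering op }

same-block : ∀ {n d} {π : Fin d → Subset n} → IsPartition π →
  ∀ {i j x} → lookup (π i) x ≡ true → lookup (π j) x ≡ true → i ≡ j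
same-block {π = π} part {i} {j} {x} x∈i x∈j =
  IsPartition.disjoint part i j x (VP.lookup⇒[]= x (π i) x∈i) (VP.lookup⇒[]= x (π j) x∈j)

jellyfish-columns : ∀ {n d N} r (π : Fin d → Subset n) (T : Tableau n d N) → Bool.T (isJellyfish r π T) →
  ∀ j → colEntries T j ≡ elems (π j)
jellyfish-columns {d = d} r π T isJ j =
  toWitness (tabulate⁻ (all⁺ _ (allFin d) (proj₂ (Equivalence.to T-∧ isJ))) j)

module Counting where

  open import Data.Nat using (_+_; _*_)
  open import Data.Nat.Solver using (module +-*-Solver)
  open import Algebra.Properties.CommutativeSemigroup ℕP.+-commutativeSemigroup
    using (interchange) renaming (x∙yz≈y∙xz to +-left-comm)
  open import Algebra.Properties.CommutativeMonoid.Sum ℕP.+-0-commutativeMonoid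
    using (sum; ∑-distrib-+; sum-remove; sum-cong-≗; sum-replicate-zero)

  𝟙 : Bool → ℕ
  𝟙 true  = 1
  𝟙 false = 0

  𝟙-false : ∀ {b} → b ≢ true → 𝟙 b ≡ 0
  𝟙-false {true}  b≢true = ⊥-elim (b≢true refl)
  𝟙-false {false} _      = refl

  count : ∀ {n} → Fin n → List (Fin n) → ℕ
  count x []       = 0
  count x (y ∷ ys) = 𝟙 (does (y ≟ x)) + count x ys

  count-++ : ∀ {n} (x : Fin n) xs ys → count x (xs ++ ys) ≡ count x xs + count x ys
  count-++ x []       ys = refl
  count-++ x (y ∷ xs) ys = trans (cong (𝟙 (does (y ≟ x)) +_) (count-++ x xs ys)) (sym (ℕP.+-assoc (𝟙 (does (y ≟ x))) _ _))

  count-map-suc : ∀ {n} (x : Fin n) xs → count (F.suc x) (map F.suc xs) ≡ count x xs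
  count-map-suc x []       = refl
  count-map-suc x (y ∷ ys) = cong (𝟙 (does (y ≟ x)) +_) (count-map-suc x ys)

  count-zero-map-suc : ∀ {n} (xs : List (Fin n)) → count F.zero (map F.suc xs) ≡ 0
  count-zero-map-suc []       = refl
  count-zero-map-suc (y ∷ ys) = count-zero-map-suc ys

  count-members : ∀ {n} (x : Fin n) B → count x (members B) ≡ 𝟙 (lookup B x)
  count-members F.zero    (true  V.∷ B) = cong suc (count-zero-map-suc (members B))
  count-members F.zero    (false V.∷ B) = count-zero-map-suc (members B)
  count-members (F.suc x) (true  V.∷ B) = trans (count-map-suc x (members B)) (count-members x B)
  count-members (F.suc x) (false V.∷ B) = trans (count-map-suc x (members B)) (count-members x B)

  countBelow : ∀ {n} → Fin n → List (Fin n) → ℕ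
  countBelow x ys = length (filter (_<? x) ys)

  countBelow-∷ : ∀ {n} (x y : Fin n) ys → countBelow x (y ∷ ys) ≡ 𝟙 (does (y <? x)) + countBelow x ys
  countBelow-∷ x y ys with does (y <? x)
  ... | true  = refl
  ... | false = refl

  countBelow-zero : ∀ {n} (ys : List (Fin (suc n))) → countBelow F.zero ys ≡ 0
  countBelow-zero []       = refl
  countBelow-zero (y ∷ ys) = trans (countBelow-∷ F.zero y ys) (countBelow-zero ys)

  countBelow-map-suc : ∀ {n} (x : Fin n) ys → countBelow (F.suc x) (map F.suc ys) ≡ countBelow x ys
  countBelow-map-suc x []       = refl
  countBelow-map-suc x (y ∷ ys) =
    trans (countBelow-∷ (F.suc x) (F.suc y) (map F.suc ys))
          (trans (cong (𝟙 (does (y <? x)) +_) (countBelow-map-suc x ys)) (sym (countBelow-∷ x y ys)))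

  countBelow-swap : ∀ {n} (u : Fin n) U x y V → countBelow u (U ++ x ∷ y ∷ V) ≡ countBelow u (U ++ y ∷ x ∷ V)
  countBelow-swap u U x y V = ↭P.↭-length (↭P.filter-↭ (_<? u) (↭P.++⁺ˡ U (swap x y ↭-refl)))

  inversions-map-suc : ∀ {n} (xs : List (Fin n)) → inversions (map F.suc xs) ≡ inversions xs
  inversions-map-suc []       = refl
  inversions-map-suc (x ∷ xs) = cong₂ _+_ (countBelow-map-suc x xs) (inversions-map-suc xs)

  inversions-allFin : ∀ n → inversions (allFin n) ≡ 0
  inversions-allFin zero    = refl
  inversions-allFin (suc n) =
    trans (cong (λ xs → inversions (F.zero ∷ xs)) (sym (LP.map-tabulate {n = n} id F.suc)))
          (cong₂ _+_ (countBelow-zero (map F.suc (allFin n))) (trans (inversions-map-suc (allFin n)) (inversions-allFin n)))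

  inversions-swap-descent : ∀ {n} U {x y : Fin n} V → toℕ y < toℕ x →
    inversions (U ++ x ∷ y ∷ V) ≡ suc (inversions (U ++ y ∷ x ∷ V))
  inversions-swap-descent [] {x} {y} V y<x = begin
      countBelow x (y ∷ V) + (countBelow y V + inversions V)
    ≡⟨ cong (_+ (countBelow y V + inversions V)) (countBelow-∷ x y V) ⟩
      𝟙 (does (y <? x)) + countBelow x V + (countBelow y V + inversions V)
    ≡⟨ cong (λ b → 𝟙 b + countBelow x V + (countBelow y V + inversions V)) (dec-true (y <? x) y<x) ⟩
      suc (countBelow x V + (countBelow y V + inversions V))
    ≡⟨ cong suc (+-left-comm (countBelow x V) (countBelow y V) (inversions V)) ⟩
      suc (countBelow y V + (countBelow x V + inversions V))
    ≡⟨ cong (λ b → suc (𝟙 b + countBelow y V + (countBelow x V + inversions V))) (sym (dec-false (x <? y) (ℕP.<-asym y<x))) ⟩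
      suc (𝟙 (does (x <? y)) + countBelow y V + (countBelow x V + inversions V))
    ≡⟨ cong (λ c → suc (c + (countBelow x V + inversions V))) (sym (countBelow-∷ y x V)) ⟩
      suc (countBelow y (x ∷ V) + (countBelow x V + inversions V))
    ∎
    where open ≡-Reasoning
  inversions-swap-descent (u ∷ U) {x} {y} V y<x =
    trans (cong₂ _+_ (countBelow-swap u U x y V) (inversions-swap-descent U V y<x))
          (ℕP.+-suc (countBelow u (U ++ y ∷ x ∷ V)) (inversions (U ++ y ∷ x ∷ V)))

  inversions-tabulate-descent : ∀ {n m} (f : Fin (suc n) → Fin m) k → toℕ (f (F.suc k)) < toℕ (f (inject₁ k)) →
    inversions (tabulate f) ≡ suc (inversions (tabulate (f ∘ swapAdj k)))
  inversions-tabulate-descent f k descent with tabulate-swapAdj k f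
  ... | U , V , unswapped , swapped =
    trans (cong inversions unswapped) (trans (inversions-swap-descent U V descent) (cong (suc ∘ inversions) (sym swapped)))

  orderedPairs : ∀ {n} → Fin n → Fin n → List (Fin n) → ℕ
  orderedPairs u v []       = 0
  orderedPairs u v (x ∷ xs) = 𝟙 (does (x ≟ u)) * count v xs + orderedPairs u v xs

  𝟙-≟-disjoint : ∀ {n} {u v : Fin n} → u ≢ v → ∀ x → 𝟙 (does (x ≟ u)) * 𝟙 (does (x ≟ v)) ≡ 0
  𝟙-≟-disjoint {u = u} {v} u≢v x with x ≟ u | x ≟ v
  ... | yes x≡u | yes x≡v = ⊥-elim (u≢v (trans (sym x≡u) x≡v))
  ... | yes _   | no _    = refl
  ... | no _    | _       = refl

  orderedPairs-+ : ∀ {n} {u v : Fin n} → u ≢ v → ∀ L →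
    orderedPairs u v L + orderedPairs v u L ≡ count u L * count v L
  orderedPairs-+ u≢v [] = refl
  orderedPairs-+ {u = u} {v} u≢v (x ∷ xs) = begin
      (eu * cv + orderedPairs u v xs) + (ev * cu + orderedPairs v u xs)
    ≡⟨ sym (ℕP.+-identityʳ _) ⟩
      (eu * cv + orderedPairs u v xs) + (ev * cu + orderedPairs v u xs) + 0
    ≡⟨ cong ((eu * cv + orderedPairs u v xs) + (ev * cu + orderedPairs v u xs) +_) (sym (𝟙-≟-disjoint u≢v x)) ⟩
      (eu * cv + orderedPairs u v xs) + (ev * cu + orderedPairs v u xs) + eu * ev
    ≡⟨ expand eu ev cu cv (orderedPairs u v xs) (orderedPairs v u xs) ⟩
      eu * ev + eu * cv + cu * ev + (orderedPairs u v xs + orderedPairs v u xs)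
    ≡⟨ cong (eu * ev + eu * cv + cu * ev +_) (orderedPairs-+ u≢v xs) ⟩
      eu * ev + eu * cv + cu * ev + cu * cv
    ≡⟨ factor eu ev cu cv ⟩
      (eu + cu) * (ev + cv)
    ∎
    where
    open ≡-Reasoning
    open +-*-Solver
    eu ev cu cv : ℕ
    eu = 𝟙 (does (x ≟ u))
    ev = 𝟙 (does (x ≟ v))
    cu = count u xs
    cv = count v xs
    expand : ∀ eu ev cu cv p q → (eu * cv + p) + (ev * cu + q) + eu * ev ≡ eu * ev + eu * cv + cu * ev + (p + q)
    expand = solve 6 (λ eu ev cu cv p q → (eu :* cv :+ p) :+ (ev :* cu :+ q) :+ eu :* ev
                                          := eu :* ev :+ eu :* cv :+ cu :* ev :+ (p :+ q)) refl
    factor : ∀ eu ev cu cv → eu * ev + eu * cv + cu * ev + cu * cv ≡ (eu + cu) * (ev + cv)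
    factor = solve 4 (λ eu ev cu cv → eu :* ev :+ eu :* cv :+ cu :* ev :+ cu :* cv := (eu :+ cu) :* (ev :+ cv)) refl

  -- swapAdj k preserves the relative order of every pair except {k, k+1}, which it reverses.
  swapAdj-order : ∀ {n} (k : Fin n) (x y : Fin (suc n)) →
    𝟙 (does (swapAdj k y <? swapAdj k x)) + 𝟙 (does (x ≟ F.suc k)) * 𝟙 (does (y ≟ inject₁ k))
    ≡ 𝟙 (does (y <? x)) + 𝟙 (does (x ≟ inject₁ k)) * 𝟙 (does (y ≟ F.suc k))
  swapAdj-order F.zero F.zero                F.zero                = refl
  swapAdj-order F.zero F.zero                (F.suc F.zero)        = refl
  swapAdj-order F.zero F.zero                (F.suc (F.suc y))     = refl
  swapAdj-order F.zero (F.suc F.zero)        F.zero                = refl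
  swapAdj-order F.zero (F.suc F.zero)        (F.suc F.zero)        = refl
  swapAdj-order F.zero (F.suc F.zero)        (F.suc (F.suc y))     = refl
  swapAdj-order F.zero (F.suc (F.suc x))     F.zero                = refl
  swapAdj-order F.zero (F.suc (F.suc x))     (F.suc F.zero)        = refl
  swapAdj-order F.zero (F.suc (F.suc x))     (F.suc (F.suc y))     = refl
  swapAdj-order (F.suc k) F.zero             F.zero                = refl
  swapAdj-order (F.suc k) F.zero             (F.suc y)             = refl
  swapAdj-order (F.suc k) (F.suc x)          F.zero                =
    cong suc (trans (ℕP.*-zeroʳ (𝟙 (does (x ≟ F.suc k)))) (sym (ℕP.*-zeroʳ (𝟙 (does (x ≟ inject₁ k))))))
  swapAdj-order (F.suc k) (F.suc x)          (F.suc y)             = swapAdj-order k x y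

  module _ {n} (k : Fin n) where
    private
      a b : Fin (suc n)
      a = inject₁ k
      b = F.suc k
      s : Fin (suc n) → Fin (suc n)
      s = swapAdj k

    countBelow-map-swapAdj : ∀ x ys →
      countBelow (s x) (map s ys) + 𝟙 (does (x ≟ b)) * count a ys
      ≡ countBelow x ys + 𝟙 (does (x ≟ a)) * count b ys
    countBelow-map-swapAdj x [] =
      trans (ℕP.*-zeroʳ (𝟙 (does (x ≟ b)))) (sym (ℕP.*-zeroʳ (𝟙 (does (x ≟ a)))))
    countBelow-map-swapAdj x (y ∷ ys) = begin
        countBelow (s x) (s y ∷ map s ys) + eb * (𝟙 (does (y ≟ a)) + count a ys)
      ≡⟨ cong (_+ eb * (𝟙 (does (y ≟ a)) + count a ys)) (countBelow-∷ (s x) (s y) (map s ys)) ⟩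
        (𝟙 (does (s y <? s x)) + countBelow (s x) (map s ys)) + eb * (𝟙 (does (y ≟ a)) + count a ys)
      ≡⟨ split (𝟙 (does (s y <? s x))) (countBelow (s x) (map s ys)) eb (𝟙 (does (y ≟ a))) (count a ys) ⟩
        (𝟙 (does (s y <? s x)) + eb * 𝟙 (does (y ≟ a))) + (countBelow (s x) (map s ys) + eb * count a ys)
      ≡⟨ cong₂ _+_ (swapAdj-order k x y) (countBelow-map-swapAdj x ys) ⟩
        (𝟙 (does (y <? x)) + ea * 𝟙 (does (y ≟ b))) + (countBelow x ys + ea * count b ys)
      ≡⟨ sym (split (𝟙 (does (y <? x))) (countBelow x ys) ea (𝟙 (does (y ≟ b))) (count b ys)) ⟩
        (𝟙 (does (y <? x)) + countBelow x ys) + ea * (𝟙 (does (y ≟ b)) + count b ys)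
      ≡⟨ cong (_+ ea * (𝟙 (does (y ≟ b)) + count b ys)) (sym (countBelow-∷ x y ys)) ⟩
        countBelow x (y ∷ ys) + ea * (𝟙 (does (y ≟ b)) + count b ys)
      ∎
      where
      open ≡-Reasoning
      ea eb : ℕ
      ea = 𝟙 (does (x ≟ a))
      eb = 𝟙 (does (x ≟ b))
      split : ∀ p q e f g → (p + q) + e * (f + g) ≡ (p + e * f) + (q + e * g)
      split p q e f g = trans (cong ((p + q) +_) (ℕP.*-distribˡ-+ e f g)) (interchange p q (e * f) (e * g))

    inversions-map-swapAdj : ∀ L →
      inversions (map s L) + orderedPairs b a L ≡ inversions L + orderedPairs a b L
    inversions-map-swapAdj [] = refl
    inversions-map-swapAdj (x ∷ xs) = begin
        (countBelow (s x) (map s xs) + inversions (map s xs)) + (eb * count a xs + orderedPairs b a xs)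
      ≡⟨ interchange (countBelow (s x) (map s xs)) (inversions (map s xs)) (eb * count a xs) (orderedPairs b a xs) ⟩
        (countBelow (s x) (map s xs) + eb * count a xs) + (inversions (map s xs) + orderedPairs b a xs)
      ≡⟨ cong₂ _+_ (countBelow-map-swapAdj x xs) (inversions-map-swapAdj xs) ⟩
        (countBelow x xs + ea * count b xs) + (inversions xs + orderedPairs a b xs)
      ≡⟨ interchange (countBelow x xs) (ea * count b xs) (inversions xs) (orderedPairs a b xs) ⟩
        (countBelow x xs + inversions xs) + (ea * count b xs + orderedPairs a b xs)
      ∎
      where
      open ≡-Reasoning
      ea eb : ℕ
      ea = 𝟙 (does (x ≟ a))
      eb = 𝟙 (does (x ≟ b))

    inversions-map-swapAdj-once : ∀ L → count a L ≡ 1 → count b L ≡ 1 →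
      inversions (map s L) ≡ suc (inversions L) ⊎ suc (inversions (map s L)) ≡ inversions L
    inversions-map-swapAdj-once L ca cb =
      differByOne (trans (orderedPairs-+ (inject₁≢suc k) L) (cong₂ _*_ ca cb)) (inversions-map-swapAdj L)
      where
      differByOne : ∀ {X Y P Q} → P + Q ≡ 1 → X + Q ≡ Y + P → X ≡ suc Y ⊎ suc X ≡ Y
      differByOne {X} {Y} {0} {1} _ e = inj₂ (trans (ℕP.+-comm 1 X) (trans e (ℕP.+-identityʳ Y)))
      differByOne {X} {Y} {1} {0} _ e = inj₁ (trans (sym (ℕP.+-identityʳ X)) (trans e (ℕP.+-comm Y 1)))
      differByOne {P = 0} {0} ()
      differByOne {P = 0} {suc (suc _)} ()
      differByOne {P = 1} {suc _} ()
      differByOne {P = suc (suc _)} ()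

  count-catMaybes-∷ : ∀ {n} (x : Fin n) c cs → count x (catMaybes (c ∷ cs)) ≡ count x (catMaybes (c ∷ [])) + count x (catMaybes cs)
  count-catMaybes-∷ x c cs = trans (cong (count x) (LP.catMaybes-++ (c ∷ []) cs)) (count-++ x (catMaybes (c ∷ [])) (catMaybes cs))

  count-row : ∀ {n d} (x : Fin n) (row : V.Vec (Maybe (Fin n)) d) →
    count x (catMaybes (V.toList row)) ≡ sum (λ j → count x (catMaybes (lookup row j ∷ [])))
  count-row x V.[]          = refl
  count-row x (c V.∷ row) = trans (count-catMaybes-∷ x c (V.toList row)) (cong (_ +_) (count-row x row))

  count-readingWord : ∀ {n d N} (x : Fin n) (T : Tableau n d N) →
    count x (readingWord T) ≡ sum (λ j → count x (colEntries T j))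
  count-readingWord {d = d} x V.[] = sym (sum-replicate-zero d)
  count-readingWord x (row V.∷ T) = begin
      count x (catMaybes (V.toList row) ++ readingWord T)
    ≡⟨ count-++ x (catMaybes (V.toList row)) (readingWord T) ⟩
      count x (catMaybes (V.toList row)) + count x (readingWord T)
    ≡⟨ cong₂ _+_ (count-row x row) (count-readingWord x T) ⟩
      sum (λ j → count x (catMaybes (lookup row j ∷ []))) + sum (λ j → count x (colEntries T j))
    ≡⟨ sym (∑-distrib-+ (λ j → count x (catMaybes (lookup row j ∷ []))) (λ j → count x (colEntries T j))) ⟩
      sum (λ j → count x (catMaybes (lookup row j ∷ [])) + count x (colEntries T j))
    ≡⟨ sum-cong-≗ (λ j → sym (count-catMaybes-∷ x (lookup row j) (V.toList (V.map (λ r → lookup r j) T)))) ⟩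
      sum (λ j → count x (colEntries (row V.∷ T) j))
    ∎
    where open ≡-Reasoning

  sum-single : ∀ {d} (t : Fin d → ℕ) j₀ → t j₀ ≡ 1 → (∀ j → j ≢ j₀ → t j ≡ 0) → sum t ≡ 1
  sum-single {suc d} t j₀ t₀ rest = begin
      sum t
    ≡⟨ sum-remove {i = j₀} t ⟩
      t j₀ + sum (λ i → t (F.punchIn j₀ i))
    ≡⟨ cong₂ _+_ t₀ (sum-cong-≗ {d} λ i → rest (F.punchIn j₀ i) (FP.punchInᵢ≢i j₀ i)) ⟩
      1 + sum {d} (λ _ → 0)
    ≡⟨ cong suc (sum-replicate-zero d) ⟩
      1
    ∎
    where open ≡-Reasoning

  blocks-containing : ∀ {n d} {π : Fin d → Subset n} → IsPartition π → ∀ x → sum (λ j → 𝟙 (lookup (π j) x)) ≡ 1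
  blocks-containing {π = π} part x with IsPartition.covering part x
  ... | j₀ , x∈j₀ = sum-single _ j₀ (cong 𝟙 (VP.[]=⇒lookup x∈j₀))
    (λ j j≢j₀ → 𝟙-false (λ x∈j → j≢j₀ (IsPartition.disjoint part j j₀ x (VP.lookup⇒[]= x (π j) x∈j) x∈j₀)))

  count-readingWord-jellyfish : ∀ {n d N} r {π : Fin d → Subset n} → IsPartition π →
    ∀ (T : Tableau n d N) → Bool.T (isJellyfish r π T) → ∀ x → count x (readingWord T) ≡ 1
  count-readingWord-jellyfish r {π} part T isJ x = begin
      count x (readingWord T)
    ≡⟨ count-readingWord x T ⟩
      sum (λ j → count x (colEntries T j))
    ≡⟨ sum-cong-≗ (λ j → trans (cong (count x) (trans (jellyfish-columns r π T isJ j) (elems≡members (π j))))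
                               (count-members x (π j))) ⟩
      sum (λ j → 𝟙 (lookup (π j) x))
    ≡⟨ blocks-containing part x ⟩
      1
    ∎
    where open ≡-Reasoning

open Counting

module Increasing where

  open import Data.Nat using (_+_; _∸_)

  increasing-lower : ∀ {n} (g : Fin (suc n) → ℕ) → (∀ k → g (inject₁ k) < g (F.suc k)) → ∀ i → toℕ i ≤ g i
  increasing-lower         g increasing F.zero    = z≤n
  increasing-lower {suc n} g increasing (F.suc j) =
    ℕP.≤-trans (s≤s (increasing-lower (g ∘ inject₁) (increasing ∘ inject₁) j)) (increasing j)

  increasing-upper : ∀ {n} (g : Fin (suc n) → ℕ) → (∀ k → g (inject₁ k) < g (F.suc k)) →
    ∀ i → g i + (n ∸ toℕ i) ≤ g (F.fromℕ n)
  increasing-upper {zero}  g increasing F.zero    = ℕP.≤-reflexive (ℕP.+-identityʳ (g F.zero))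
  increasing-upper {suc n} g increasing F.zero    =
    ℕP.≤-trans (ℕP.≤-reflexive (ℕP.+-suc (g F.zero) n))
               (ℕP.≤-trans (ℕP.+-monoˡ-≤ n (increasing F.zero)) (increasing-upper (g ∘ F.suc) (increasing ∘ F.suc) F.zero))
  increasing-upper {suc n} g increasing (F.suc j) = increasing-upper (g ∘ F.suc) (increasing ∘ F.suc) j

  strictlyIncreasing⇒id : ∀ {n} (f : Fin (suc n) → Fin (suc n)) →
    (∀ k → toℕ (f (inject₁ k)) < toℕ (f (F.suc k))) → ∀ i → f i ≡ i
  strictlyIncreasing⇒id {n} f increasing i = FP.toℕ-injective (ℕP.≤-antisym below (increasing-lower (toℕ ∘ f) increasing i))
    where
    i≤n : toℕ i ≤ n
    i≤n = ℕP.<⇒≤pred (FP.toℕ<n i)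
    below : toℕ (f i) ≤ toℕ i
    below = ℕP.+-cancelʳ-≤ (n ∸ toℕ i) (toℕ (f i)) (toℕ i) (begin
      toℕ (f i) + (n ∸ toℕ i)   ≤⟨ increasing-upper (toℕ ∘ f) increasing i ⟩
      toℕ (f (F.fromℕ n))       ≤⟨ ℕP.<⇒≤pred (FP.toℕ<n (f (F.fromℕ n))) ⟩
      n                         ≡⟨ ℕP.m+[n∸m]≡n i≤n ⟨
      toℕ i + (n ∸ toℕ i)       ∎)
      where open ℕP.≤-Reasoning

open Increasing

-- Descents of a permutation

permInversions : ∀ {n} → Permutation′ n → ℕ
permInversions {n} w = inversions (map (w ⟨$⟩ʳ_) (allFin n))

permInversions-descent : ∀ {n} (w : Permutation′ (suc n)) k → toℕ (w ⟨$⟩ʳ F.suc k) < toℕ (w ⟨$⟩ʳ inject₁ k) →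
  permInversions w ≡ suc (permInversions (swapAdjPerm k ∘ₚ w))
permInversions-descent w k descent =
  trans (cong inversions (LP.map-tabulate id (w ⟨$⟩ʳ_)))
        (trans (inversions-tabulate-descent (w ⟨$⟩ʳ_) k descent)
               (cong (suc ∘ inversions) (sym (LP.map-tabulate id ((w ⟨$⟩ʳ_) ∘ swapAdj k)))))

permInversions-identity : ∀ {n} (w : Permutation′ n) → (∀ i → w ⟨$⟩ʳ i ≡ i) → permInversions w ≡ 0
permInversions-identity {n} w w≗id = trans (cong inversions (trans (LP.map-cong w≗id (allFin n)) (LP.map-id (allFin n))))
                                           (inversions-allFin n)

no-descent⇒identity : ∀ {n} (w : Permutation′ (suc n)) →
  (∀ k → ¬ toℕ (w ⟨$⟩ʳ F.suc k) < toℕ (w ⟨$⟩ʳ inject₁ k)) → ∀ i → w ⟨$⟩ʳ i ≡ i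
no-descent⇒identity w no-descent = strictlyIncreasing⇒id (w ⟨$⟩ʳ_) ascent
  where
  injective : ∀ {x y} → w ⟨$⟩ʳ x ≡ w ⟨$⟩ʳ y → x ≡ y
  injective {x} {y} wx≡wy = trans (sym (inverseˡ w)) (trans (cong (w ⟨$⟩ˡ_) wx≡wy) (inverseˡ w))
  ascent : ∀ k → toℕ (w ⟨$⟩ʳ inject₁ k) < toℕ (w ⟨$⟩ʳ F.suc k)
  ascent k = ℕP.≤∧≢⇒< (ℕP.≮⇒≥ (no-descent k)) (inject₁≢suc k ∘ injective ∘ FP.toℕ-injective)

module _ {c ℓ : Level} (R : CommutativeRing c ℓ) where

  open CommutativeRing R hiding (zero) renaming (refl to ≈-refl; sym to ≈-sym; trans to ≈-trans)
  open import Algebra.Properties.Ring ring using (-0#≈0#; -‿involutive; -‿+-comm; -‿distribˡ-*; -‿distribʳ-*)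
  open import Data.List.Relation.Binary.Permutation.Setoid.Properties setoid using (foldr-commMonoid)
  open import Relation.Binary.Reasoning.Setoid setoid
  open import Algebra.Properties.CommutativeSemigroup +-commutativeSemigroup using (x∙yz≈y∙xz)

  *-negʳ : ∀ x {y y′} → y ≈ - y′ → x * y ≈ - (x * y′)
  *-negʳ x {y′ = y′} y≈-y′ = ≈-trans (*-congˡ y≈-y′) (≈-sym (-‿distribʳ-* x y′))

  sumR-↭ : ∀ {xs ys} → xs ↭ ys → sumR R xs ≈ sumR R ys
  sumR-↭ p = foldr-commMonoid +-isCommutativeMonoid (↭.↭⇒↭ₛ′ isEquivalence p)

  sumR-map-cong : ∀ {a} {A : Set a} {f g : A → Carrier} {xs} → All (λ x → f x ≈ g x) xs →
    sumR R (map f xs) ≈ sumR R (map g xs)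
  sumR-map-cong []           = ≈-refl
  sumR-map-cong (fx≈gx ∷ ps) = +-cong fx≈gx (sumR-map-cong ps)

  sumR-map-neg : ∀ {a} {A : Set a} (f : A → Carrier) xs → sumR R (map (λ x → - f x) xs) ≈ - sumR R (map f xs)
  sumR-map-neg f []       = ≈-sym -0#≈0#
  sumR-map-neg f (x ∷ xs) = ≈-trans (+-congˡ (sumR-map-neg f xs)) (-‿+-comm (f x) _)

  prodR-neg-at : ∀ {d} (F G : Fin d → Carrier) j₀ → (∀ j → j ≢ j₀ → F j ≈ G j) → F j₀ ≈ - G j₀ →
    prodR R (map F (allFin d)) ≈ - prodR R (map G (allFin d))
  prodR-neg-at {d} F G j₀ F≈G F≈-G = begin
      prodR R (map F (allFin d)) ≡⟨ cong (prodR R) (LP.map-tabulate id F) ⟩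
      prodR R (tabulate F)       ≈⟨ negate-one F G j₀ F≈G F≈-G ⟩
      - prodR R (tabulate G)     ≡⟨ cong (-_ ∘ prodR R) (sym (LP.map-tabulate id G)) ⟩
      - prodR R (map G (allFin d)) ∎
    where
    agree : ∀ {d} (F G : Fin d → Carrier) → (∀ j → F j ≈ G j) → prodR R (tabulate F) ≈ prodR R (tabulate G)
    agree {zero}  F G F≈G = ≈-refl
    agree {suc d} F G F≈G = *-cong (F≈G F.zero) (agree (F ∘ F.suc) (G ∘ F.suc) (F≈G ∘ F.suc))
    negate-one : ∀ {d} (F G : Fin d → Carrier) j₀ → (∀ j → j ≢ j₀ → F j ≈ G j) → F j₀ ≈ - G j₀ →
      prodR R (tabulate F) ≈ - prodR R (tabulate G)
    negate-one F G F.zero F≈G F≈-G =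
      ≈-trans (*-cong F≈-G (agree (F ∘ F.suc) (G ∘ F.suc) (λ j → F≈G (F.suc j) λ ()))) (≈-sym (-‿distribˡ-* _ _))
    negate-one F G (F.suc j₀) F≈G F≈-G =
      ≈-trans (*-cong (F≈G F.zero λ ()) (negate-one (F ∘ F.suc) (G ∘ F.suc) j₀ (λ j j≢ → F≈G (F.suc j) (j≢ ∘ FP.suc-injective)) F≈-G))
              (≈-sym (-‿distribʳ-* _ _))

  signR-inversions-map-swapAdj : ∀ {n} (k : Fin n) L → count (inject₁ k) L ≡ 1 → count (F.suc k) L ≡ 1 →
    signR R (inversions (map (swapAdj k) L)) ≈ - signR R (inversions L)
  signR-inversions-map-swapAdj k L once₁ once₂ with inversions-map-swapAdj-once k L once₁ once₂
  ... | inj₁ up   = reflexive (cong (signR R) up)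
  ... | inj₂ down = ≈-trans (≈-sym (-‿involutive _)) (-‿cong (reflexive (cong (signR R) down)))

  -- Cofactor expansions

  -- expansion F [x₀, …, xₘ] = ∑ₚ F p xₚ (the list with xₚ removed)
  expansion : ∀ {a} {A : Set a} → (ℕ → A → List A → Carrier) → List A → Carrier
  expansion F []       = 0#
  expansion F (x ∷ xs) = F 0 x xs + expansion (λ p y ys → F (suc p) y (x ∷ ys)) xs

  expansion-picks : ∀ {a} {A : Set a} (G : ℕ → A × List A → Carrier) (g : ℕ → ℕ) xs →
    sumR R (zipWith G (applyUpTo g (length xs)) (picks xs)) ≡ expansion (λ p y ys → G (g p) (y , ys)) xs
  expansion-picks G g []       = refl
  expansion-picks {A = A} G g (x ∷ xs) = cong (G (g 0) (x , xs) +_) (trans (cong (sumR R) shifted) (expansion-picks G′ (g ∘ suc) xs))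
    where
    G′ : ℕ → A × List A → Carrier
    G′ p (y , ys) = G p (y , x ∷ ys)
    shifted : zipWith G (applyUpTo (g ∘ suc) (length xs)) (map (λ { (y , ys) → y , x ∷ ys }) (picks xs))
            ≡ zipWith G′ (applyUpTo (g ∘ suc) (length xs)) (picks xs)
    shifted = trans (cong (λ us → zipWith G us _) (sym (LP.map-id _)))
                    (LP.zipWith-map G id _ (applyUpTo (g ∘ suc) (length xs)) (picks xs))

  expansion-cong : ∀ {a} {A : Set a} {F G : ℕ → A → List A → Carrier} → (∀ p y ys → F p y ys ≈ G p y ys) →
    ∀ xs → expansion F xs ≈ expansion G xs
  expansion-cong F≈G []       = ≈-refl
  expansion-cong F≈G (x ∷ xs) = +-cong (F≈G 0 x xs) (expansion-cong (λ p y ys → F≈G (suc p) y (x ∷ ys)) xs)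

  expansion-neg : ∀ {a} {A : Set a} {F G : ℕ → A → List A → Carrier} → (∀ p y ys → F p y ys ≈ - G p y ys) →
    ∀ xs → expansion F xs ≈ - expansion G xs
  expansion-neg F≈-G []       = ≈-sym -0#≈0#
  expansion-neg F≈-G (x ∷ xs) =
    ≈-trans (+-cong (F≈-G 0 x xs) (expansion-neg (λ p y ys → F≈-G (suc p) y (x ∷ ys)) xs)) (-‿+-comm _ _)

  expansion-map : ∀ {a b} {A : Set a} {B : Set b} (F : ℕ → B → List B → Carrier) (f : A → B) xs →
    expansion F (map f xs) ≡ expansion (λ p y ys → F p (f y) (map f ys)) xs
  expansion-map F f []       = refl
  expansion-map F f (x ∷ xs) = cong (F 0 (f x) (map f xs) +_) (expansion-map (λ p y ys → F (suc p) y (f x ∷ ys)) f xs)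

  -- The terms removing u and v are exchanged up to sign by the second hypothesis; all others are negated by the first.
  expansion-swap : ∀ {a} {A : Set a} (F : ℕ → A → List A → Carrier) →
    (∀ p y U u v V → F p y (U ++ u ∷ v ∷ V) ≈ - F p y (U ++ v ∷ u ∷ V)) →
    (∀ p y ys → F (suc p) y ys ≈ - F p y ys) →
    ∀ U u v V → expansion F (U ++ u ∷ v ∷ V) ≈ - expansion F (U ++ v ∷ u ∷ V)
  expansion-swap {A = A} F alternating signed [] u v V = begin
      F 0 u (v ∷ V) + (F 1 v (u ∷ V) + expansion F₂ V)
    ≈⟨ +-cong (≈-trans (≈-sym (-‿involutive _)) (-‿cong (≈-sym (signed 0 u (v ∷ V)))))
              (+-cong (signed 0 v (u ∷ V)) (expansion-neg (λ p y ys → alternating (suc (suc p)) y [] u v ys) V)) ⟩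
      - F 1 u (v ∷ V) + (- F 0 v (u ∷ V) + - expansion F₂′ V)
    ≈⟨ +-congˡ (-‿+-comm _ _) ⟩
      - F 1 u (v ∷ V) + - (F 0 v (u ∷ V) + expansion F₂′ V)
    ≈⟨ -‿+-comm _ _ ⟩
      - (F 1 u (v ∷ V) + (F 0 v (u ∷ V) + expansion F₂′ V))
    ≈⟨ -‿cong (x∙yz≈y∙xz _ _ _) ⟩
      - (F 0 v (u ∷ V) + (F 1 u (v ∷ V) + expansion F₂′ V))
    ∎
    where
    F₂ F₂′ : ℕ → A → List A → Carrier
    F₂  p y ys = F (suc (suc p)) y (u ∷ v ∷ ys)
    F₂′ p y ys = F (suc (suc p)) y (v ∷ u ∷ ys)
  expansion-swap F alternating signed (w ∷ U) u v V =
    ≈-trans (+-cong (alternating 0 w U u v V)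
                    (expansion-swap (λ p y ys → F (suc p) y (w ∷ ys))
                                    (λ p y U′ → alternating (suc p) y (w ∷ U′))
                                    (λ p y ys → signed (suc p) y (w ∷ ys)) U u v V))
            (-‿+-comm _ _)

  minorDet-expand : ∀ {m k} (X : Fin m → Fin k → Carrier) i is js →
    minorDet R X (i ∷ is) js ≡ expansion (λ p y ys → signR R p * (X i y * minorDet R X is ys)) js
  minorDet-expand X i is js = expansion-picks (λ p jr → signR R p * (X i (proj₁ jr) * minorDet R X is (proj₂ jr))) id js

  minorDet-cong : ∀ {m k} {X Y : Fin m → Fin k → Carrier} → (∀ i j → X i j ≈ Y i j) → ∀ I J → minorDet R X I J ≈ minorDet R Y I J
  minorDet-cong X≈Y []      []      = ≈-refl
  minorDet-cong X≈Y []      (_ ∷ _) = ≈-refl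
  minorDet-cong {X = X} {Y} X≈Y (i ∷ I) J = begin
    minorDet R X (i ∷ I) J
      ≡⟨ minorDet-expand X i I J ⟩
    expansion (λ p y ys → signR R p * (X i y * minorDet R X I ys)) J
      ≈⟨ expansion-cong (λ p y ys → *-congˡ (*-cong (X≈Y i y) (minorDet-cong X≈Y I ys))) J ⟩
    expansion (λ p y ys → signR R p * (Y i y * minorDet R Y I ys)) J
      ≡⟨ minorDet-expand Y i I J ⟨
    minorDet R Y (i ∷ I) J ∎

  minorDet-map-columns : ∀ {m k k′} (Y : Fin m → Fin k′ → Carrier) (f : Fin k → Fin k′) I J →
    minorDet R (λ i j → Y i (f j)) I J ≈ minorDet R Y I (map f J)
  minorDet-map-columns Y f []      []      = ≈-refl
  minorDet-map-columns Y f []      (_ ∷ _) = ≈-refl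
  minorDet-map-columns Y f (i ∷ I) J = begin
    minorDet R (λ i j → Y i (f j)) (i ∷ I) J
      ≡⟨ minorDet-expand (λ i j → Y i (f j)) i I J ⟩
    expansion (λ p y ys → signR R p * (Y i (f y) * minorDet R (λ i j → Y i (f j)) I ys)) J
      ≈⟨ expansion-cong (λ p y ys → *-congˡ (*-congˡ (minorDet-map-columns Y f I ys))) J ⟩
    expansion (λ p y ys → signR R p * (Y i (f y) * minorDet R Y I (map f ys))) J
      ≡⟨ expansion-map (λ p y ys → signR R p * (Y i y * minorDet R Y I ys)) f J ⟨
    expansion (λ p y ys → signR R p * (Y i y * minorDet R Y I ys)) (map f J)
      ≡⟨ minorDet-expand Y i I (map f J) ⟨
    minorDet R Y (i ∷ I) (map f J) ∎

  minorDet-swap-columns : ∀ {m k} (X : Fin m → Fin k → Carrier) I U u v V →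
    minorDet R X I (U ++ u ∷ v ∷ V) ≈ - minorDet R X I (U ++ v ∷ u ∷ V)
  minorDet-swap-columns X []      []      u v V = ≈-sym -0#≈0#
  minorDet-swap-columns X []      (_ ∷ _) u v V = ≈-sym -0#≈0#
  minorDet-swap-columns {k = k} X (i ∷ I) U u v V = begin
    minorDet R X (i ∷ I) (U ++ u ∷ v ∷ V)
      ≡⟨ minorDet-expand X i I (U ++ u ∷ v ∷ V) ⟩
    expansion F (U ++ u ∷ v ∷ V)
      ≈⟨ expansion-swap F alternating signed U u v V ⟩
    - expansion F (U ++ v ∷ u ∷ V)
      ≡⟨ cong -_ (minorDet-expand X i I (U ++ v ∷ u ∷ V)) ⟨
    - minorDet R X (i ∷ I) (U ++ v ∷ u ∷ V) ∎
    where
    F : ℕ → Fin k → List (Fin k) → Carrier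
    F p y ys = signR R p * (X i y * minorDet R X I ys)
    alternating : ∀ p y U u v V → F p y (U ++ u ∷ v ∷ V) ≈ - F p y (U ++ v ∷ u ∷ V)
    alternating p y U u v V = *-negʳ (signR R p) (*-negʳ (X i y) (minorDet-swap-columns X I U u v V))
    signed : ∀ p y ys → F (suc p) y ys ≈ - F p y ys
    signed p y ys = ≈-sym (-‿distribˡ-* _ _)

  -- Brackets

  signedTerm : ∀ {n d} r (π : Fin d → Subset n) → (Fin n → Fin n → Carrier) → Tableau n d (jRows n d r) → Carrier
  signedTerm r π X T = signR R (inversions (readingWord T)) * jMonomial R r π X T

  -- The row embedding of jMonomial, so that rowIndices unfolds to the row sets of its minors.
  embedRow : ∀ n d r → Fin (jRows n d r) → Fin n
  embedRow n d r i = F.inject≤ i (ℕP.m∸n≤m n ((d ℕ.∸ 1) ℕ.* r))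

  rowIndices : ∀ {n d} r → Tableau n d (jRows n d r) → Fin d → List (Fin n)
  rowIndices {n} {d} r T j = map (embedRow n d r) (rowsOf T j)

  prodR-map-cong : ∀ {a} {A : Set a} {f g : A → Carrier} → (∀ x → f x ≈ g x) → ∀ xs → prodR R (map f xs) ≈ prodR R (map g xs)
  prodR-map-cong f≈g []       = ≈-refl
  prodR-map-cong f≈g (x ∷ xs) = *-cong (f≈g x) (prodR-map-cong f≈g xs)

  bracket-cong-matrix : ∀ {n d} r (π : Fin d → Subset n) {X Y : Fin n → Fin n → Carrier} → (∀ i j → X i j ≈ Y i j) →
    bracket R r π X ≈ bracket R r π Y
  bracket-cong-matrix {d = d} r π {X} {Y} X≈Y = sumR-map-cong {f = signedTerm r π X} {g = signedTerm r π Y} {jellyfish r π} (All.tabulate λ {T} _ →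
    *-congˡ (prodR-map-cong (λ j → minorDet-cong X≈Y (rowIndices r T j) (elems (π j))) (allFin d)))

  bracket-cong-blocks : ∀ {n d} r {π π′ : Fin d → Subset n} X → (∀ j → π j ≡ π′ j) → bracket R r π X ≡ bracket R r π′ X
  bracket-cong-blocks {n} {d} r {π} {π′} X π≡π′ =
    trans (cong (sumR R) (LP.map-cong (λ T → cong (signR R (inversions (readingWord T)) *_) (monomial T)) (jellyfish r π)))
          (cong (sumR R ∘ map (signedTerm r π′ X)) (filterᵇ-cong shape (allTableaux n d (jRows n d r))))
    where
    monomial : ∀ T → jMonomial R r π X T ≡ jMonomial R r π′ X T
    monomial T = cong (prodR R) (LP.map-cong (λ j → cong (minorDet R X (rowIndices r T j) ∘ elems) (π≡π′ j)) (allFin d))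
    shape : ∀ T → isJellyfish r π T ≡ isJellyfish r π′ T
    shape T = cong₂ _∧_ refl (cong and (LP.map-cong (λ j → cong (λ B → ⌊ LP.≡-dec _≟_ (colEntries T j) (elems B) ⌋) (π≡π′ j)) (allFin d)))

  module _ {n d : ℕ} (r : ℕ) (k : Fin n) {π : Fin d → Subset (suc n)} (part : IsPartition π) where

    private
      a b : Fin (suc n)
      a = inject₁ k
      b = F.suc k
      s : Permutation′ (suc n)
      s = swapAdjPerm k

    bracket-swapAdj-same-block : ∀ j₀ → lookup (π j₀) a ≡ true → lookup (π j₀) b ≡ true →
      ∀ Y → bracket R r π (actMatrix R s Y) ≈ - bracket R r (actPartition s π) Y
    bracket-swapAdj-same-block j₀ a∈j₀ b∈j₀ Y = begin
        sumR R (map (signedTerm r π (actMatrix R s Y)) (jellyfish r π))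
      ≈⟨ sumR-map-cong {f = signedTerm r π (actMatrix R s Y)} {g = λ T → - signedTerm r π Y T} {jellyfish r π}
                       (All.tabulate λ {T} _ → *-negʳ (signR R (inversions (readingWord T))) (monomial T)) ⟩
        sumR R (map (λ T → - signedTerm r π Y T) (jellyfish r π))
      ≈⟨ sumR-map-neg (signedTerm r π Y) (jellyfish r π) ⟩
        - bracket R r π Y
      ≡⟨ cong -_ (bracket-cong-blocks r Y (λ j → sym (fixed j))) ⟩
        - bracket R r (actPartition s π) Y
      ∎
      where
      same-membership : ∀ j → lookup (π j) a ≡ lookup (π j) b
      same-membership j with lookup (π j) a in a∈j | lookup (π j) b in b∈j
      ... | true  | true  = refl
      ... | false | false = refl
      ... | true  | false with refl ← same-block part a∈j a∈j₀ = contradiction (trans (sym b∈j₀) b∈j) λ ()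
      ... | false | true  with refl ← same-block part b∈j b∈j₀ = contradiction (trans (sym a∈j₀) a∈j) λ ()
      fixed : ∀ j → actPartition s π j ≡ π j
      fixed j = actBlock-swapAdj-fixes k (π j) (same-membership j)
      unmoved : ∀ j → j ≢ j₀ → map (swapAdj k) (elems (π j)) ≡ elems (π j)
      unmoved j j≢j₀ =
        trans (cong (map (swapAdj k)) (elems≡members (π j)))
              (trans (sym (members-actBlock-swapAdj k (π j) (λ a∈j _ → j≢j₀ (same-block part a∈j a∈j₀))))
                     (trans (cong members (fixed j)) (sym (elems≡members (π j)))))
      monomial : ∀ T → jMonomial R r π (actMatrix R s Y) T ≈ - jMonomial R r π Y T
      monomial T = prodR-neg-at _ _ j₀
        (λ j j≢j₀ → ≈-trans (minorDet-map-columns Y (swapAdj k) (rowIndices r T j) (elems (π j)))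
                            (reflexive (cong (minorDet R Y (rowIndices r T j)) (unmoved j j≢j₀))))
        swapped-block
        where
        I : List (Fin (suc n))
        I = rowIndices r T j₀
        swapped-block : minorDet R (actMatrix R s Y) I (elems (π j₀)) ≈ - minorDet R Y I (elems (π j₀))
        swapped-block with members-swapAdj-both k (π j₀) a∈j₀ b∈j₀
        ... | U , W , sorted , swapped = begin
          minorDet R (actMatrix R s Y) I (elems (π j₀))       ≈⟨ minorDet-map-columns Y (swapAdj k) I (elems (π j₀)) ⟩
          minorDet R Y I (map (swapAdj k) (elems (π j₀)))     ≡⟨ cong (minorDet R Y I) (trans (cong (map (swapAdj k)) (elems≡members (π j₀))) swapped) ⟩
          minorDet R Y I (U ++ b ∷ a ∷ W)                      ≈⟨ minorDet-swap-columns Y I U b a W ⟩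
          - minorDet R Y I (U ++ a ∷ b ∷ W)                    ≡⟨ cong (-_ ∘ minorDet R Y I) (trans (elems≡members (π j₀)) sorted) ⟨
          - minorDet R Y I (elems (π j₀))                      ∎

    bracket-swapAdj-split : (∀ j → lookup (π j) a ≡ true → lookup (π j) b ≡ true → ⊥) →
      ∀ Y → bracket R r π (actMatrix R s Y) ≈ - bracket R r (actPartition s π) Y
    bracket-swapAdj-split notBoth Y = begin
        sumR R (map (signedTerm r π (actMatrix R s Y)) (jellyfish r π))
      ≈⟨ sumR-map-cong {f = signedTerm r π (actMatrix R s Y)} {g = λ T → - signedTerm r π′ Y (Ψ T)} {jellyfish r π}
                       (All.map (λ {T} → term T) (all-filter (T? ∘ isJellyfish r π) (allTableaux (suc n) d (jRows (suc n) d r)))) ⟩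
        sumR R (map (λ T → - signedTerm r π′ Y (Ψ T)) (jellyfish r π))
      ≈⟨ sumR-map-neg (signedTerm r π′ Y ∘ Ψ) (jellyfish r π) ⟩
        - sumR R (map (signedTerm r π′ Y ∘ Ψ) (jellyfish r π))
      ≡⟨ cong (-_ ∘ sumR R) (LP.map-∘ (jellyfish r π)) ⟩
        - sumR R (map (signedTerm r π′ Y) (map Ψ (jellyfish r π)))
      ≈⟨ -‿cong (sumR-↭ (↭P.map⁺ (signedTerm r π′ Y) (↭-sym relabel))) ⟩
        - bracket R r π′ Y
      ∎
      where
      π′ : Fin d → Subset (suc n)
      π′ = actPartition s π
      Ψ : Tableau (suc n) d (jRows (suc n) d r) → Tableau (suc n) d (jRows (suc n) d r)
      Ψ = mapTableau (swapAdj k)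
      blocks : ∀ j → map (swapAdj k) (elems (π j)) ≡ elems (π′ j)
      blocks j = trans (cong (map (swapAdj k)) (elems≡members (π j)))
                       (trans (sym (members-actBlock-swapAdj k (π j) (notBoth j))) (sym (elems≡members (π′ j))))
      relabel : jellyfish r π′ ↭ map Ψ (jellyfish r π)
      relabel = jellyfish-mapTableau-↭ r π π′ (swapAdj k) (swapAdj-injective k) (swapAdj-permutes-allFin k) blocks
      term : ∀ T → Bool.T (isJellyfish r π T) → signedTerm r π (actMatrix R s Y) T ≈ - signedTerm r π′ Y (Ψ T)
      term T isJ = begin
          sign T * jMonomial R r π (actMatrix R s Y) T
        ≈⟨ -‿involutive _ ⟨
          - - (sign T * jMonomial R r π (actMatrix R s Y) T)
        ≈⟨ -‿cong (-‿distribˡ-* _ _) ⟩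
          - (- sign T * jMonomial R r π (actMatrix R s Y) T)
        ≈⟨ -‿cong (*-cong (≈-sym sign-Ψ) (≈-sym monomial-Ψ)) ⟩
          - (sign (Ψ T) * jMonomial R r π′ Y (Ψ T))
        ∎
        where
        sign : Tableau (suc n) d (jRows (suc n) d r) → Carrier
        sign T = signR R (inversions (readingWord T))
        once : ∀ x → count x (readingWord T) ≡ 1
        once = count-readingWord-jellyfish r part T isJ
        sign-Ψ : sign (Ψ T) ≈ - sign T
        sign-Ψ = ≈-trans (reflexive (cong (signR R ∘ inversions) (readingWord-mapTableau (swapAdj k) T)))
                         (signR-inversions-map-swapAdj k (readingWord T) (once a) (once b))
        monomial-Ψ : jMonomial R r π′ Y (Ψ T) ≈ jMonomial R r π (actMatrix R s Y) T
        monomial-Ψ = prodR-map-cong (λ j → ≈-trans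
          (reflexive (cong₂ (minorDet R Y) (cong (map (embedRow (suc n) d r)) (rowsOf-mapTableau (swapAdj k) T j)) (sym (blocks j))))
          (≈-sym (minorDet-map-columns Y (swapAdj k) (rowIndices r T j) (elems (π j))))) (allFin d)

    bracket-swapAdj : ∀ Y → bracket R r π (actMatrix R s Y) ≈ - bracket R r (actPartition s π) Y
    bracket-swapAdj Y with FP.any? (λ j → (lookup (π j) a Bool.≟ true) ×-dec (lookup (π j) b Bool.≟ true))
    ... | yes (j₀ , a∈j₀ , b∈j₀) = bracket-swapAdj-same-block j₀ a∈j₀ b∈j₀ Y
    ... | no no-block            = bracket-swapAdj-split (λ j a∈j b∈j → no-block (j , a∈j , b∈j)) Y

  SignEquivariant : ℕ → ℕ → ∀ {n} → Permutation′ n → Set (c ⊔ ℓ)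
  SignEquivariant d r {n} w = ∀ {π : Fin d → Subset n} → IsPartition π → ∀ X →
    bracket R r π (actMatrix R w X) ≈ sgnPerm R w * bracket R r (actPartition w π) X

  signEquivariant-identity : ∀ {n} d r (w : Permutation′ n) → (∀ i → w ⟨$⟩ʳ i ≡ i) → SignEquivariant d r w
  signEquivariant-identity d r w w≗id {π} _ X = begin
      bracket R r π (actMatrix R w X)
    ≈⟨ bracket-cong-matrix r π (λ i j → reflexive (cong (X i) (w≗id j))) ⟩
      bracket R r π X
    ≡⟨ bracket-cong-blocks r X (λ j → sym (trans (VP.tabulate-cong (cong (lookup (π j)) ∘ inverse-identity)) (VP.tabulate∘lookup (π j)))) ⟩
      bracket R r (actPartition w π) X
    ≈⟨ *-identityˡ _ ⟨
      1# * bracket R r (actPartition w π) X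
    ≡⟨ cong (λ m → signR R m * bracket R r (actPartition w π) X) (permInversions-identity w w≗id) ⟨
      sgnPerm R w * bracket R r (actPartition w π) X
    ∎
    where
    inverse-identity : ∀ i → w ⟨$⟩ˡ i ≡ i
    inverse-identity i = trans (cong (w ⟨$⟩ˡ_) (sym (w≗id i))) (inverseˡ w)

  signEquivariant-swapAdj : ∀ {n} d r (k : Fin n) (w : Permutation′ (suc n)) →
    permInversions w ≡ suc (permInversions (swapAdjPerm k ∘ₚ w)) →
    SignEquivariant d r (swapAdjPerm k ∘ₚ w) → SignEquivariant d r w
  signEquivariant-swapAdj d r k w fewer equivariant {π} part X = begin
      bracket R r π (actMatrix R w X)
    ≈⟨ bracket-cong-matrix r π (λ i j → reflexive (cong (X i ∘ (w ⟨$⟩ʳ_)) (sym (swapAdj-involutive k j)))) ⟩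
      bracket R r π (actMatrix R s (actMatrix R w′ X))
    ≈⟨ bracket-swapAdj r k part (actMatrix R w′ X) ⟩
      - bracket R r (actPartition s π) (actMatrix R w′ X)
    ≈⟨ -‿cong (equivariant (isPartition-act s part) X) ⟩
      - (sgnPerm R w′ * bracket R r (actPartition w′ (actPartition s π)) X)
    ≡⟨ cong (λ t → - (sgnPerm R w′ * t)) (bracket-cong-blocks r X blocks) ⟩
      - (sgnPerm R w′ * bracket R r (actPartition w π) X)
    ≈⟨ -‿distribˡ-* _ _ ⟩
      - sgnPerm R w′ * bracket R r (actPartition w π) X
    ≡⟨ cong (λ m → signR R m * bracket R r (actPartition w π) X) fewer ⟨
      sgnPerm R w * bracket R r (actPartition w π) X
    ∎
    where
    s : Permutation′ (suc _)
    s = swapAdjPerm k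
    w′ : Permutation′ (suc _)
    w′ = s ∘ₚ w
    blocks : ∀ j → actPartition w′ (actPartition s π) j ≡ actPartition w π j
    blocks j = VP.tabulate-cong (λ i → trans (VP.lookup∘tabulate (lookup (π j) ∘ (s ⟨$⟩ˡ_)) (s ⟨$⟩ˡ (w ⟨$⟩ˡ i)))
                                             (cong (lookup (π j)) (swapAdj-involutive k (w ⟨$⟩ˡ i))))

  signEquivariant : ∀ {n} d r (w : Permutation′ (suc n)) → SignEquivariant d r w
  signEquivariant {n} d r w = by-inversions (permInversions w) w refl
    where
    by-inversions : ∀ m (w : Permutation′ (suc n)) → permInversions w ≡ m → SignEquivariant d r w
    by-inversions m w w-inversions
      with FP.any? (λ k → (w ⟨$⟩ʳ F.suc k) <? (w ⟨$⟩ʳ inject₁ k))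
    ... | no no-descent = signEquivariant-identity d r w (no-descent⇒identity w (λ k descent → no-descent (k , descent)))
    ... | yes (k , descent) with m | trans (sym (permInversions-descent w k descent)) w-inversions
    ...   | zero   | ()
    ...   | suc m′ | fewer = signEquivariant-swapAdj d r k w (permInversions-descent w k descent)
                               (by-inversions m′ (swapAdjPerm k ∘ₚ w) (ℕP.suc-injective fewer))

proposition5p7 : ∀ {c ℓ : Level} (R : CommutativeRing c ℓ) (n d r : ℕ)
    → 1 ≤ n → 1 ≤ d → 1 ≤ r
    → (π : Fin d → Subset n) → IsOP n d r π
    → (w : Permutation′ n)
    → (X : Fin n → Fin n → CommutativeRing.Carrier R)
    → CommutativeRing._≈_ R
        (bracket R r π (actMatrix R w X))
        (CommutativeRing._*_ R (sgnPerm R w) (bracket R r (actPartition w π) X))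
proposition5p7 R (suc n) d r _ _ _ π op w X = signEquivariant R d r w (isOP⇒isPartition op) X
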